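{- $\mathbf P_{\mathrm{IS}}=\mathrm{P/poly}$, where each Boolean function family $(f_n)_{n\in\mathbb N}$ is identified with the unique function $f:\mathbb B^*\to\mathbb B$ such that $f(w)=f_n(w)$ for each $n$ and $w\in\mathbb B^n$.
   Context: Let $\mathbb B=\{\mathsf T,\mathsf F\}$. There are Boolean registers named $\mathtt{in}{:}i$ ($i\ge1$), $\mathtt{aux}{:}i$ ($i\ge1$) and $\mathtt{out}$, processing methods $\mathtt{set{:}T}$ (content becomes $\mathsf T$, reply $\mathsf T$), $\mathtt{set{:}F}$ (content becomes $\mathsf F$, reply $\mathsf F$), $\mathtt{get}$ (no change, reply is the content). Basic instructions are $f.m$ ($f$ register name, $m$ method). Primitive instructions: for each basic instruction $a$, the plain instruction $a$, positive test $+a$, negative test $-a$; forward jumps $\#l$ ($l\in\mathbb N$); termination $!$. An instruction sequence is a finite non-empty sequence $X=u_1;\dots;u_k$ of primitive instructions, $|X|=k$. Execution starts at $u_1$: $a$ executes $a$ and proceeds with the next instruction; $+a$ executes $a$ and proceeds with the next instruction if the reply is $\mathsf T$, otherwise skips the next instruction and proceeds with the one after; $-a$ likewise with reply roles reversed; $\#l$ proceeds with the $l$-th next instruction ($\#0$ causes inaction); $!$ terminates; if there is no instruction to proceed with, inaction occurs. $\mathcal{IS}_{br}$ is the set of instruction sequences whose basic instructions are all of the forms $\mathtt{in}{:}i.\mathtt{get}$, $\mathtt{aux}{:}i.\mathtt{get}$, $\mathtt{aux}{:}i.\mathtt{set{:}}b$, $\mathtt{out}.\mathtt{set{:}}b$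 ($b\in\mathbb B$). $X$ computes $f:\mathbb B^n\to\mathbb B$ if for all $b_1,\dots,b_n$, executing $X$ with $\mathtt{in}{:}i$ initially $b_i$ ($i\le n$) and all auxiliary registers and $\mathtt{out}$ initially $\mathsf F$, execution never executes an instruction on $\mathtt{in}{:}i$ with $i>n$, ends by executing $!$, and leaves $f(b_1,\dots,b_n)$ in $\mathtt{out}$. A Boolean function family is a sequence $(f_n)_{n\in\mathbb N}$ with $f_n:\mathbb B^n\to\mathbb B$. $\mathbf P_{\mathrm{IS}}$ is the class of Boolean function families $(f_n)$ for which there is a polynomial $h:\mathbb N\to\mathbb N$ such that for every $n$ some $X\in\mathcal{IS}_{br}$ computes $f_n$ with $|X|\le h(n)$. $\mathrm{P/poly}$ is the standard non-uniform complexity class (functions computable by polynomial-size Boolean circuit families). -}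

module Defs where

open import Data.Bool using (Bool; true; false; if_then_else_)
open import Data.Nat using (ℕ; zero; suc; _+_; _*_; _^_; _≤_; _<?_)
open import Data.Fin using (Fin)
open import Data.Vec using (Vec; lookup; _∷_; [])
open import Data.List using (List; []; _∷_; drop; length)
open import Data.List.NonEmpty using (List⁺; toList)
open import Data.Product using (∃; ∃-syntax; Σ-syntax; _×_)
open import Data.Fin using (fromℕ<)
open import Relation.Nullary using (yes; no)
open import Relation.Binary.PropositionalEquality using (_≡_)
open import Function.Bundles using (_⇔_)

BoolFunFamily : Set
BoolFunFamily = (n : ℕ) → Vec Bool n → Bool

-- Polynomial with natural-number coefficients, c₀ ∷ c₁ ∷ … ∷ [].
evalPoly : List ℕ → ℕ → ℕ
evalPoly []       x = 0
evalPoly (c ∷ cs) x = c + x * evalPoly cs x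

-- Register indices are shifted: (in: i) denotes register in:(i+1),
-- (aux: i) denotes register aux:(i+1).
-- Basic instructions allowed in IS_br.
data BasicInstr : Set where
  in:get    : ℕ → BasicInstr
  aux:get   : ℕ → BasicInstr
  aux:set   : ℕ → Bool → BasicInstr
  out:set   : Bool → BasicInstr

data PrimInstr : Set where
  plain : BasicInstr → PrimInstr
  ptest : BasicInstr → PrimInstr       -- +a
  ntest : BasicInstr → PrimInstr       -- -a
  jump  : ℕ → PrimInstr                -- #l
  halt  : PrimInstr                    -- !

InstrSeq : Set
InstrSeq = List⁺ PrimInstr

isLength : InstrSeq → ℕ
isLength X = length (toList X)

record State : Set where
  constructor ⟨_,_⟩
  field
    aux : ℕ → Bool
    out : Bool

data StepResult : Set where
  ok    : Bool → State → StepResult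
  error : StepResult

update : (ℕ → Bool) → ℕ → Bool → (ℕ → Bool)
update r i b j with i Data.Nat.≟ j
... | yes _ = b
... | no  _ = r j

doBasic : ∀ {n} → Vec Bool n → BasicInstr → State → StepResult
doBasic {n} w (in:get i) s with i <? n
... | yes p = ok (lookup w (fromℕ< p)) s
... | no  _ = error
doBasic w (aux:get i)   ⟨ a , o ⟩ = ok (a i) ⟨ a , o ⟩
doBasic w (aux:set i b) ⟨ a , o ⟩ = ok b ⟨ update a i b , o ⟩
doBasic w (out:set b)   ⟨ a , o ⟩ = ok b ⟨ a , b ⟩

-- Outcome of a run: termination by ! with content of out, or failure
-- (inaction, or an instruction on in:i with i > n).
data Outcome : Set where
  terminated : Bool → Outcome
  failed     : Outcome

-- Every step other than #0 moves strictly
-- forward, so fuel |X|+1 never runs out except on the looping #0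
-- (inaction), which is then correctly reported as failure.
run : ∀ {n} → Vec Bool n → ℕ → List PrimInstr → State → Outcome
run w zero    _          s = failed
run w (suc k) []         s = failed
run w (suc k) (halt ∷ us) s = terminated (State.out s)
run w (suc k) (jump l ∷ us) s = run w k (drop l (jump l ∷ us)) s
run w (suc k) (plain a ∷ us) s with doBasic w a s
... | error  = failed
... | ok r s' = run w k us s'
run w (suc k) (ptest a ∷ us) s with doBasic w a s
... | error  = failed
... | ok r s' = run w k (if r then us else drop 1 us) s'
run w (suc k) (ntest a ∷ us) s with doBasic w a s
... | error  = failed
... | ok r s' = run w k (if r then drop 1 us else us) s'

initState : State
initState = ⟨ (λ _ → false) , false ⟩

execute : ∀ {n} → InstrSeq → Vec Bool n → Outcome
execute X w = run w (suc (isLength X)) (toList X) initState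

Computes : ∀ {n} → InstrSeq → (Vec Bool n → Bool) → Set
Computes X f = ∀ w → execute X w ≡ terminated (f w)

P-IS : BoolFunFamily → Set
P-IS f = ∃[ h ] ∀ n → ∃[ X ] (Computes X (f n) × isLength X ≤ evalPoly h n)

data Gate (m : ℕ) : Set where
  const : Bool → Gate m
  not   : Fin m → Gate m
  and   : Fin m → Fin m → Gate m
  or    : Fin m → Fin m → Gate m

-- Gates n k : a list of k gates over n inputs; each new gate may use the
-- n inputs and all previous gates (wire 0 is the most recent gate).
data Gates (n : ℕ) : ℕ → Set where
  []  : Gates n 0
  _▷_ : ∀ {k} → Gates n k → Gate (k + n) → Gates n (suc k)

evalGate : ∀ {m} → Vec Bool m → Gate m → Bool
evalGate v (const b) = b
evalGate v (not i)   = Data.Bool.not (lookup v i)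
evalGate v (and i j) = lookup v i Data.Bool.∧ lookup v j
evalGate v (or i j)  = lookup v i Data.Bool.∨ lookup v j

wires : ∀ {n k} → Gates n k → Vec Bool n → Vec Bool (k + n)
wires []       x = x
wires (g ▷ gt) x = let v = wires g x in evalGate v gt ∷ v

record Circuit (n : ℕ) : Set where
  field
    size   : ℕ
    gates  : Gates n size
    output : Fin (size + n)

evalCircuit : ∀ {n} → Circuit n → Vec Bool n → Bool
evalCircuit C x = lookup (wires (Circuit.gates C) x) (Circuit.output C)

P/poly : BoolFunFamily → Set
P/poly f = ∃[ h ] ∀ n → Σ[ C ∈ Circuit n ]
  ((∀ x → evalCircuit C x ≡ f n x) × Circuit.size C ≤ evalPoly h n)

-- Both inclusions are linear-size compilations, so polynomial bounds carry over.
--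
-- A circuit becomes an instruction sequence that evaluates its gates in order, keeping
-- each gate value in its own auxiliary register; a gate costs at most four instructions.
--
-- Conversely, every jump goes forward, so a run visits the instructions of X in increasing
-- order.  It can therefore be replayed by a single left-to-right sweep over X that records,
-- for each instruction ahead, whether control reaches it, and executes each instruction
-- guarded by that flag.  Every flag, register and the result of the sweep is a Boolean
-- combination of values computed earlier in the sweep; performing the sweep symbolically,
-- with wires in place of Booleans, yields a circuit with at most eight gates per instruction.
module Submission where

open import Data.Bool using (Bool; true; false; if_then_else_; _∧_; _∨_) renaming (not to notᵇ)
open import Data.Bool.Properties using (∨-idem; ∧-zeroʳ; ∨-identityʳ)
open import Data.Empty using (⊥-elim)
open import Data.Fin using (Fin; zero; suc; toℕ; fromℕ<)
open import Data.Fin.Properties using (toℕ<n; fromℕ<-toℕ)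
open import Data.List using (List; []; _∷_; length; drop; map)
open import Data.List.NonEmpty using (_∷_; toList)
open import Data.List.Properties using (length-drop; drop-[])
open import Data.Nat using (ℕ; zero; suc; _+_; _*_; _∸_; _≤_; _<_; s≤s; z<s; _≟_; _<?_)
open import Data.Nat.Properties
open import Data.Nat.Tactic.RingSolver using (solve-∀)
open import Data.Product using (_×_; _,_; proj₁; proj₂)
open import Data.Vec using (Vec; lookup; _∷_; [])
open import Function.Bundles using (_⇔_; mk⇔)
open import Relation.Nullary using (yes; no)
open import Relation.Binary.PropositionalEquality
open import Defs

-- Polynomial bounds

affinePoly : ℕ → ℕ → List ℕ → List ℕ
affinePoly a b []       = a ∷ []
affinePoly a b (c ∷ cs) = a + b * c ∷ map (b *_) cs

evalPoly-scale : ∀ b cs x → evalPoly (map (b *_) cs) x ≡ b * evalPoly cs x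
evalPoly-scale b []       x = sym (*-zeroʳ b)
evalPoly-scale b (c ∷ cs) x = begin
  b * c + x * evalPoly (map (b *_) cs) x ≡⟨ cong (λ e → b * c + x * e) (evalPoly-scale b cs x) ⟩
  b * c + x * (b * evalPoly cs x)         ≡⟨ lemma b c x (evalPoly cs x) ⟩
  b * (c + x * evalPoly cs x)             ∎
  where
  open ≡-Reasoning
  lemma : ∀ b c x e → b * c + x * (b * e) ≡ b * (c + x * e)
  lemma = solve-∀

evalPoly-affine : ∀ a b h x → evalPoly (affinePoly a b h) x ≡ a + b * evalPoly h x
evalPoly-affine a b []       x = lemma a b x
  where
  lemma : ∀ a b x → a + x * 0 ≡ a + b * 0
  lemma = solve-∀
evalPoly-affine a b (c ∷ cs) x = begin
  a + b * c + x * evalPoly (map (b *_) cs) x ≡⟨ cong (λ e → a + b * c + x * e) (evalPoly-scale b cs x) ⟩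
  a + b * c + x * (b * evalPoly cs x)         ≡⟨ lemma a b c x (evalPoly cs x) ⟩
  a + b * (c + x * evalPoly cs x)             ∎
  where
  open ≡-Reasoning
  lemma : ∀ a b c x e → a + b * c + x * (b * e) ≡ a + b * (c + x * e)
  lemma = solve-∀

affinePoly-bound : ∀ a b h {m x} → m ≤ evalPoly h x → a + b * m ≤ evalPoly (affinePoly a b h) x
affinePoly-bound a b h {x = x} m≤h =
  ≤-trans (+-monoʳ-≤ a (*-monoʳ-≤ b m≤h)) (≤-reflexive (sym (evalPoly-affine a b h x)))

-- From circuits to instruction sequences

-- Gate number k (counting from the inputs, from 0) is computed into aux:(k+1).  Registers
-- start at F, so a gate only has to write when its value is T.
module _ {n : ℕ} where

  readWire : ∀ k → Fin (k + n) → BasicInstr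
  readWire zero    i       = in:get (toℕ i)
  readWire (suc k) zero    = aux:get k
  readWire (suc k) (suc i) = readWire k i

  gateCode : ∀ k → Gate (k + n) → List PrimInstr → List PrimInstr
  gateCode k (const true)  us = plain (aux:set k true) ∷ us
  gateCode k (const false) us = us
  gateCode k (not i)       us = ntest (readWire k i) ∷ plain (aux:set k true) ∷ us
  gateCode k (and i j)     us = ntest (readWire k i) ∷ jump 3 ∷ ptest (readWire k j) ∷ plain (aux:set k true) ∷ us
  gateCode k (or i j)      us = ptest (readWire k i) ∷ jump 2 ∷ ptest (readWire k j) ∷ plain (aux:set k true) ∷ us

  gatesCode : ∀ {k} → Gates n k → List PrimInstr → List PrimInstr
  gatesCode []                 us = us
  gatesCode {suc k} (gs ▷ g) us = gatesCode gs (gateCode k g us)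

  outputCode : ∀ k → Fin (k + n) → List PrimInstr
  outputCode k i = ptest (readWire k i) ∷ plain (out:set true) ∷ halt ∷ []

  -- The leading #1 is a no-op; it only supplies the head of the non-empty sequence.
  circuitCode : Circuit n → InstrSeq
  circuitCode C = jump 1 ∷ gatesCode (Circuit.gates C) (outputCode (Circuit.size C) (Circuit.output C))

  length-gateCode : ∀ k g us → length (gateCode k g us) ≤ 4 + length us
  length-gateCode k (const true)  us = s≤s (m≤n+m _ 3)
  length-gateCode k (const false) us = m≤n+m _ 4
  length-gateCode k (not i)       us = s≤s (s≤s (m≤n+m _ 2))
  length-gateCode k (and i j)     us = ≤-refl
  length-gateCode k (or i j)      us = ≤-refl

  length-gatesCode : ∀ {k} (gs : Gates n k) us → length (gatesCode gs us) ≤ 4 * k + length us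
  length-gatesCode []                 us = ≤-refl
  length-gatesCode {suc k} (gs ▷ g) us = begin
    length (gatesCode gs (gateCode k g us)) ≤⟨ length-gatesCode gs _ ⟩
    4 * k + length (gateCode k g us)        ≤⟨ +-monoʳ-≤ (4 * k) (length-gateCode k g us) ⟩
    4 * k + (4 + length us)                 ≡⟨ lemma k (length us) ⟩
    4 * suc k + length us                   ∎
    where
    open ≤-Reasoning
    lemma : ∀ k l → 4 * k + (4 + l) ≡ 4 * suc k + l
    lemma = solve-∀

  isLength-circuitCode : ∀ C → isLength (circuitCode C) ≤ 4 + 4 * Circuit.size C
  isLength-circuitCode C =
    ≤-trans (s≤s (length-gatesCode (Circuit.gates C) _)) (≤-reflexive (cong suc (+-comm _ 3)))

length-drop-≤ : ∀ {A : Set} l (us : List A) → length (drop l us) ≤ length us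
length-drop-≤ l us = ≤-trans (≤-reflexive (length-drop l us)) (m∸n≤m (length us) l)

module _ {n : ℕ} (x : Vec Bool n) where

  Halts : List PrimInstr → State → Bool → Set
  Halts us s o = ∀ K → length us < K → run x K us s ≡ terminated o

  halts-halt : ∀ {us s} → Halts (halt ∷ us) s (State.out s)
  halts-halt (suc K) _ = refl

  halts-plain : ∀ {a us s r s' o} → doBasic x a s ≡ ok r s' → Halts us s' o → Halts (plain a ∷ us) s o
  halts-plain eq h (suc K) (s≤s lt) rewrite eq = h K lt

  halts-shorter : ∀ (us : List PrimInstr) {us' s o} → length us' ≤ length us → Halts us' s o →
                  ∀ K → length us < K → run x K us' s ≡ terminated o
  halts-shorter us us'≤us h K lt = h K (≤-<-trans us'≤us lt)

  halts-ptest : ∀ {a us s r s' o} → doBasic x a s ≡ ok r s' →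
                Halts (if r then us else drop 1 us) s' o → Halts (ptest a ∷ us) s o
  halts-ptest {us = us} {r = r} eq h (suc K) (s≤s lt) rewrite eq = halts-shorter us (length-if r) h K lt
    where
    length-if : ∀ r → length (if r then us else drop 1 us) ≤ length us
    length-if true  = ≤-refl
    length-if false = length-drop-≤ 1 us

  halts-ntest : ∀ {a us s r s' o} → doBasic x a s ≡ ok r s' →
                Halts (if r then drop 1 us else us) s' o → Halts (ntest a ∷ us) s o
  halts-ntest {us = us} {r = r} eq h (suc K) (s≤s lt) rewrite eq = halts-shorter us (length-if r) h K lt
    where
    length-if : ∀ r → length (if r then drop 1 us else us) ≤ length us
    length-if true  = length-drop-≤ 1 us
    length-if false = ≤-refl

  halts-jump : ∀ {l us s o} → Halts (drop l us) s o → Halts (jump (suc l) ∷ us) s o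
  halts-jump {l} {us} h (suc K) (s≤s lt) = halts-shorter us (length-drop-≤ l us) h K lt

  registerValue : ∀ k → Fin (k + n) → State → Bool
  registerValue zero    i       s = lookup x i
  registerValue (suc k) zero    s = State.aux s k
  registerValue (suc k) (suc i) s = registerValue k i s

  doBasic-readWire : ∀ k i s → doBasic x (readWire k i) s ≡ ok (registerValue k i s) s
  doBasic-readWire zero i s with toℕ i <? n
  ... | yes i<n = cong (λ j → ok (lookup x j) s) (fromℕ<-toℕ i i<n)
  ... | no  i≮n = ⊥-elim (i≮n (toℕ<n i))
  doBasic-readWire (suc k) zero    s = refl
  doBasic-readWire (suc k) (suc i) s = doBasic-readWire k i s

  registerValue-frame : ∀ k i s s' → (∀ j → j < k → State.aux s j ≡ State.aux s' j) →
                        registerValue k i s ≡ registerValue k i s'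
  registerValue-frame zero    i       s s' eq = refl
  registerValue-frame (suc k) zero    s s' eq = eq k ≤-refl
  registerValue-frame (suc k) (suc i) s s' eq = registerValue-frame k i s s' (λ j j<k → eq j (m<n⇒m<1+n j<k))

  record Encodes {k} (gs : Gates n k) (s : State) : Set where
    field
      wire     : ∀ i → registerValue k i s ≡ lookup (wires gs x) i
      unused   : ∀ j → k ≤ j → State.aux s j ≡ false
      out-init : State.out s ≡ false

  recordGate : ℕ → Bool → State → State
  recordGate k true  s = ⟨ update (State.aux s) k true , State.out s ⟩
  recordGate k false s = s

  encodes-initState : Encodes [] initState
  encodes-initState = record { wire = λ _ → refl ; unused = λ _ _ → refl ; out-init = refl }

  encodes-▷ : ∀ {k} {gs : Gates n k} {s} g → Encodes gs s →
              Encodes (gs ▷ g) (recordGate k (evalGate (wires gs x) g) s)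
  encodes-▷ {k} {gs} {s} g enc = record
    { wire     = λ { zero    → new-wire v
                   ; (suc i) → trans (sym (registerValue-frame k i s _ (old-aux v))) (wire i) }
    ; unused   = new-unused v
    ; out-init = new-out v }
    where
    open Encodes enc
    v = evalGate (wires gs x) g
    new-wire : ∀ v → State.aux (recordGate k v s) k ≡ v
    new-wire true with k ≟ k
    ... | yes _   = refl
    ... | no  k≢k = ⊥-elim (k≢k refl)
    new-wire false = unused k ≤-refl
    old-aux : ∀ v j → j < k → State.aux s j ≡ State.aux (recordGate k v s) j
    old-aux true j j<k with k ≟ j
    ... | yes refl = ⊥-elim (<-irrefl refl j<k)
    ... | no  _    = refl
    old-aux false j j<k = refl
    new-unused : ∀ v j → suc k ≤ j → State.aux (recordGate k v s) j ≡ false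
    new-unused true j k<j with k ≟ j
    ... | yes refl = ⊥-elim (<-irrefl refl k<j)
    ... | no  _    = unused j (<⇒≤ k<j)
    new-unused false j k<j = unused j (<⇒≤ k<j)
    new-out : ∀ v → State.out (recordGate k v s) ≡ false
    new-out true  = out-init
    new-out false = out-init

  module _ {k : ℕ} {a : BasicInstr} {us : List PrimInstr} {s : State} {o : Bool} where

    halts-not : ∀ {u} → doBasic x a s ≡ ok u s → Halts us (recordGate k (notᵇ u) s) o →
                Halts (ntest a ∷ plain (aux:set k true) ∷ us) s o
    halts-not {true}  ra h = halts-ntest ra h
    halts-not {false} ra h = halts-ntest ra (halts-plain refl h)

    halts-and : ∀ {b u v} → doBasic x a s ≡ ok u s → doBasic x b s ≡ ok v s →
                Halts us (recordGate k (u ∧ v) s) o →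
                Halts (ntest a ∷ jump 3 ∷ ptest b ∷ plain (aux:set k true) ∷ us) s o
    halts-and {u = false}         ra rb h = halts-ntest ra (halts-jump h)
    halts-and {u = true}  {false} ra rb h = halts-ntest ra (halts-ptest rb h)
    halts-and {u = true}  {true}  ra rb h = halts-ntest ra (halts-ptest rb (halts-plain refl h))

    halts-or : ∀ {b u v} → doBasic x a s ≡ ok u s → doBasic x b s ≡ ok v s →
               Halts us (recordGate k (u ∨ v) s) o →
               Halts (ptest a ∷ jump 2 ∷ ptest b ∷ plain (aux:set k true) ∷ us) s o
    halts-or {u = true}          ra rb h = halts-ptest ra (halts-jump (halts-plain refl h))
    halts-or {u = false} {false} ra rb h = halts-ptest ra (halts-ptest rb h)
    halts-or {u = false} {true}  ra rb h = halts-ptest ra (halts-ptest rb (halts-plain refl h))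

  doBasic-readWire-encodes : ∀ {k} {gs : Gates n k} {s} → Encodes gs s →
                             ∀ i → doBasic x (readWire k i) s ≡ ok (lookup (wires gs x) i) s
  doBasic-readWire-encodes {k} {s = s} enc i =
    trans (doBasic-readWire k i s) (cong (λ b → ok b s) (Encodes.wire enc i))

  halts-gateCode : ∀ {k} {gs : Gates n k} {s us o} g → Encodes gs s →
                   Halts us (recordGate k (evalGate (wires gs x) g) s) o → Halts (gateCode k g us) s o
  halts-gateCode (const true)  enc h = halts-plain refl h
  halts-gateCode (const false) enc h = h
  halts-gateCode (not i)       enc h = halts-not (doBasic-readWire-encodes enc i) h
  halts-gateCode (and i j)     enc h = halts-and (doBasic-readWire-encodes enc i) (doBasic-readWire-encodes enc j) h
  halts-gateCode (or i j)      enc h = halts-or (doBasic-readWire-encodes enc i) (doBasic-readWire-encodes enc j) h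

  halts-gatesCode : ∀ {k} (gs : Gates n k) {us o} → (∀ {s} → Encodes gs s → Halts us s o) →
                    Halts (gatesCode gs us) initState o
  halts-gatesCode []       h = h encodes-initState
  halts-gatesCode (gs ▷ g) h = halts-gatesCode gs (λ enc → halts-gateCode g enc (h (encodes-▷ g enc)))

  halts-outputCode : ∀ {k} {gs : Gates n k} {s} i → Encodes gs s →
                     Halts (outputCode k i) s (lookup (wires gs x) i)
  halts-outputCode {k} {s = s} i enc = output-case (doBasic-readWire-encodes enc i)
    where
    output-case : ∀ {v} → doBasic x (readWire k i) s ≡ ok v s → Halts (outputCode k i) s v
    output-case {true}  ri = halts-ptest ri (halts-plain refl halts-halt)
    output-case {false} ri = halts-ptest ri (subst (Halts (halt ∷ []) s) (Encodes.out-init enc) halts-halt)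

  execute-circuitCode : ∀ C → execute (circuitCode C) x ≡ terminated (evalCircuit C x)
  execute-circuitCode C =
    halts-jump {0} (halts-gatesCode (Circuit.gates C) (halts-outputCode (Circuit.output C))) _ ≤-refl

-- Circuits with gates addressed by level

-- Wire levels count upwards from the bottom of a vector of wire values: the inputs occupy
-- levels 0 … n-1 (input i at level n-1-i) and each new gate gets the next level.  Levels do
-- not change when the vector grows, unlike the indices used by Gate.
lookupLevel : ∀ {m} → Vec Bool m → ℕ → Bool
lookupLevel []            a = false
lookupLevel {suc m} (b ∷ v) a with a ≟ m
... | yes _ = b
... | no  _ = lookupLevel v a

lookupLevel-top : ∀ {m} b (v : Vec Bool m) → lookupLevel (b ∷ v) m ≡ b
lookupLevel-top {m} b v with m ≟ m
... | yes _   = refl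
... | no  m≢m = ⊥-elim (m≢m refl)

lookupLevel-below : ∀ {m} b (v : Vec Bool m) {a} → a ≢ m → lookupLevel (b ∷ v) a ≡ lookupLevel v a
lookupLevel-below {m} b v {a} a≢m with a ≟ m
... | yes a≡m = ⊥-elim (a≢m a≡m)
... | no  _   = refl

lookupLevel-≥ : ∀ {m} (v : Vec Bool m) {a} → m ≤ a → lookupLevel v a ≡ false
lookupLevel-≥ []      _   = refl
lookupLevel-≥ (b ∷ v) m<a =
  trans (lookupLevel-below b v (λ { refl → <-irrefl refl m<a })) (lookupLevel-≥ v (<⇒≤ m<a))

lookupLevel-input : ∀ {n} (v : Vec Bool n) {i} (i<n : i < n) →
                    lookupLevel v (n ∸ suc i) ≡ lookup v (fromℕ< i<n)
lookupLevel-input (b ∷ v) {zero}  _           = lookupLevel-top b v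
lookupLevel-input {suc n} (b ∷ v) {suc i} (s≤s i<n) =
  trans (lookupLevel-below b v (<⇒≢ (∸-monoʳ-< {n} {suc i} {0} z<s i<n))) (lookupLevel-input v i<n)

levelIndex : ∀ m a → a < m → Fin m
levelIndex (suc m) a a<1+m with a ≟ m
... | yes _   = zero
... | no  a≢m = suc (levelIndex m a (≤∧≢⇒< (≤-pred a<1+m) a≢m))

lookup-levelIndex : ∀ {m} (v : Vec Bool m) a a<m → lookup v (levelIndex m a a<m) ≡ lookupLevel v a
lookup-levelIndex {suc m} (b ∷ v) a a<1+m with a ≟ m
... | yes _ = refl
... | no  _ = lookup-levelIndex v a _

data LGate : Set where
  const : Bool → LGate
  not   : ℕ → LGate
  and   : ℕ → ℕ → LGate
  or    : ℕ → ℕ → LGate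

evalLGate : (ℕ → Bool) → LGate → Bool
evalLGate val (const b) = b
evalLGate val (not a)   = notᵇ (val a)
evalLGate val (and a b) = val a ∧ val b
evalLGate val (or a b)  = val a ∨ val b

evalLGate-cong : ∀ {val val'} g → (∀ a → val a ≡ val' a) → evalLGate val g ≡ evalLGate val' g
evalLGate-cong (const b) eq = refl
evalLGate-cong (not a)   eq = cong notᵇ (eq a)
evalLGate-cong (and a b) eq = cong₂ _∧_ (eq a) (eq b)
evalLGate-cong (or a b)  eq = cong₂ _∨_ (eq a) (eq b)

-- Operands at levels ≥ m read as F, as in lookupLevel.
indexGate : ∀ {m} → LGate → Gate m
indexGate (const b) = const b
indexGate {m} (not a) with a <? m
... | yes a<m = not (levelIndex m a a<m)
... | no  _   = const true
indexGate {m} (and a b) with a <? m | b <? m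
... | yes a<m | yes b<m = and (levelIndex m a a<m) (levelIndex m b b<m)
... | _       | _       = const false
indexGate {m} (or a b) with a <? m | b <? m
... | yes a<m | yes b<m = or (levelIndex m a a<m) (levelIndex m b b<m)
... | yes a<m | no  _   = or (levelIndex m a a<m) (levelIndex m a a<m)
... | no  _   | yes b<m = or (levelIndex m b b<m) (levelIndex m b b<m)
... | no  _   | no  _   = const false

evalGate-indexGate : ∀ {m} (v : Vec Bool m) g → evalGate v (indexGate g) ≡ evalLGate (lookupLevel v) g
evalGate-indexGate v (const b) = refl
evalGate-indexGate {m} v (not a) with a <? m
... | yes a<m = cong notᵇ (lookup-levelIndex v a a<m)
... | no  a≮m = cong notᵇ (sym (lookupLevel-≥ v (≮⇒≥ a≮m)))
evalGate-indexGate {m} v (and a b) with a <? m | b <? m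
... | yes a<m | yes b<m = cong₂ _∧_ (lookup-levelIndex v a a<m) (lookup-levelIndex v b b<m)
... | yes _   | no  b≮m rewrite lookupLevel-≥ v (≮⇒≥ b≮m) = sym (∧-zeroʳ _)
... | no  a≮m | _       rewrite lookupLevel-≥ v (≮⇒≥ a≮m) = refl
evalGate-indexGate {m} v (or a b) with a <? m | b <? m
... | yes a<m | yes b<m = cong₂ _∨_ (lookup-levelIndex v a a<m) (lookup-levelIndex v b b<m)
... | yes a<m | no  b≮m rewrite lookupLevel-≥ v (≮⇒≥ b≮m) | lookup-levelIndex v a a<m =
  trans (∨-idem _) (sym (∨-identityʳ _))
... | no  a≮m | yes b<m rewrite lookupLevel-≥ v (≮⇒≥ a≮m) | lookup-levelIndex v b b<m = ∨-idem _
... | no  a≮m | no  b≮m rewrite lookupLevel-≥ v (≮⇒≥ a≮m) | lookupLevel-≥ v (≮⇒≥ b≮m) = refl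

data _⊑_ (P : List LGate) : List LGate → Set where
  ⊑-refl : P ⊑ P
  ⊑-∷    : ∀ {g Q} → P ⊑ Q → P ⊑ (g ∷ Q)

⊑-trans : ∀ {P Q R} → P ⊑ Q → Q ⊑ R → P ⊑ R
⊑-trans P⊑Q ⊑-refl      = P⊑Q
⊑-trans P⊑Q (⊑-∷ Q⊑R) = ⊑-∷ (⊑-trans P⊑Q Q⊑R)

[]⊑ : ∀ P → [] ⊑ P
[]⊑ []      = ⊑-refl
[]⊑ (g ∷ P) = ⊑-∷ ([]⊑ P)

-- A gate list is kept newest first; its gates sit at levels n, n+1, … above the inputs.
module _ {n : ℕ} where

  width : List LGate → ℕ
  width P = length P + n

  wireValue : Vec Bool n → List LGate → ℕ → Bool
  wireValue x []      a = lookupLevel x a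
  wireValue x (g ∷ P) a with a ≟ width P
  ... | yes _ = evalLGate (wireValue x P) g
  ... | no  _ = wireValue x P a

  toGates : (P : List LGate) → Gates n (length P)
  toGates []      = []
  toGates (g ∷ P) = toGates P ▷ indexGate g

  lookupLevel-wires : ∀ x P a → lookupLevel (wires (toGates P) x) a ≡ wireValue x P a
  lookupLevel-wires x []      a = refl
  lookupLevel-wires x (g ∷ P) a with a ≟ width P
  ... | yes _ = trans (evalGate-indexGate (wires (toGates P) x) g) (evalLGate-cong g (lookupLevel-wires x P))
  ... | no  _ = lookupLevel-wires x P a

  record Carries (x : Vec Bool n) (P : List LGate) (a : ℕ) (b : Bool) : Set where
    constructor carries
    field
      defined : a < width P
      value   : wireValue x P a ≡ b

  module _ {x : Vec Bool n} where

    carries-∷ : ∀ {P g a b} → Carries x P a b → Carries x (g ∷ P) a b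
    carries-∷ {P} {g} {a} (carries a<w val) = carries (m<n⇒m<1+n a<w) (trans wireValue-below val)
      where
      wireValue-below : wireValue x (g ∷ P) a ≡ wireValue x P a
      wireValue-below with a ≟ width P
      ... | yes refl = ⊥-elim (<-irrefl refl a<w)
      ... | no  _    = refl

    carries-⊑ : ∀ {P Q a b} → P ⊑ Q → Carries x P a b → Carries x Q a b
    carries-⊑ ⊑-refl    c = c
    carries-⊑ (⊑-∷ P⊑Q) c = carries-∷ (carries-⊑ P⊑Q c)

    carries-new : ∀ {P} g {b} → evalLGate (wireValue x P) g ≡ b → Carries x (g ∷ P) (width P) b
    carries-new {P} g eq = carries ≤-refl (trans wireValue-top eq)
      where
      wireValue-top : wireValue x (g ∷ P) (width P) ≡ evalLGate (wireValue x P) g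
      wireValue-top with width P ≟ width P
      ... | yes _   = refl
      ... | no  w≢w = ⊥-elim (w≢w refl)

    carries-not : ∀ {P a u} → Carries x P a u → Carries x (not a ∷ P) (width P) (notᵇ u)
    carries-not (carries _ eu) = carries-new (not _) (cong notᵇ eu)

    carries-and : ∀ {P a b u v} → Carries x P a u → Carries x P b v →
                  Carries x (and a b ∷ P) (width P) (u ∧ v)
    carries-and (carries _ eu) (carries _ ev) = carries-new (and _ _) (cong₂ _∧_ eu ev)

    carries-or : ∀ {P a b u v} → Carries x P a u → Carries x P b v →
                 Carries x (or a b ∷ P) (width P) (u ∨ v)
    carries-or (carries _ eu) (carries _ ev) = carries-new (or _ _) (cong₂ _∨_ eu ev)

    carries-input : ∀ P {i} (i<n : i < n) → Carries x P (n ∸ suc i) (lookup x (fromℕ< i<n))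
    carries-input P {i} i<n = carries-⊑ ([]⊑ P)
      (carries (∸-monoʳ-< {n} {suc i} {0} z<s i<n) (lookupLevel-input x i<n))

-- Replaying a run by a forward sweep

shift : ∀ {A : Set} → (ℕ → A) → ℕ → A
shift p j = p (suc j)

flowTo : ℕ → Bool → (ℕ → Bool) → ℕ → Bool
flowTo zero    c p zero    = p 0 ∨ c
flowTo zero    c p (suc j) = p (suc j)
flowTo (suc t) c p zero    = p 0
flowTo (suc t) c p (suc j) = flowTo t c (shift p) j

branch : Bool → Bool → (ℕ → Bool) → ℕ → Bool
branch c r p = flowTo 1 (c ∧ notᵇ r) (flowTo 0 (c ∧ r) (shift p))

Silent : (ℕ → Bool) → Set
Silent p = ∀ j → p j ≡ false

OnlyAt : ℕ → (ℕ → Bool) → Set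
OnlyAt zero    p = p 0 ≡ true  × Silent (shift p)
OnlyAt (suc d) p = p 0 ≡ false × OnlyAt d (shift p)

flowTo-false : ∀ t p j → flowTo t false p j ≡ p j
flowTo-false zero    p zero    = ∨-identityʳ (p 0)
flowTo-false zero    p (suc j) = refl
flowTo-false (suc t) p zero    = refl
flowTo-false (suc t) p (suc j) = flowTo-false t (shift p) j

onlyAt-cong : ∀ d {p q} → (∀ j → p j ≡ q j) → OnlyAt d p → OnlyAt d q
onlyAt-cong zero    p≗q (p₀ , rest) = trans (sym (p≗q 0)) p₀ , λ j → trans (sym (p≗q (suc j))) (rest j)
onlyAt-cong (suc d) p≗q (p₀ , rest) = trans (sym (p≗q 0)) p₀ , onlyAt-cong d (λ j → p≗q (suc j)) rest

onlyAt-flowTo : ∀ t {p} → Silent p → OnlyAt t (flowTo t true p)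
onlyAt-flowTo zero    silent rewrite silent 0 = refl , λ j → silent (suc j)
onlyAt-flowTo (suc t) silent = silent 0 , onlyAt-flowTo t (λ j → silent (suc j))

onlyAt-branch-true : ∀ p → Silent (shift p) → OnlyAt 0 (branch true true p)
onlyAt-branch-true p silent =
  onlyAt-cong 0 (λ j → sym (flowTo-false 1 (flowTo 0 true (shift p)) j)) (onlyAt-flowTo 0 silent)

onlyAt-branch-false : ∀ p → Silent (shift p) → OnlyAt 1 (branch true false p)
onlyAt-branch-false p silent = onlyAt-flowTo 1 (λ j → trans (flowTo-false 0 (shift p) j) (silent j))

-- active j tells whether control reaches the j-th instruction ahead of the sweep, and
-- result collects the content of out at every ! that is reached.
record Sweep : Set where
  constructor ⟪_,_,_⟫
  field
    active : ℕ → Bool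
    state  : State
    result : Bool

initialSweep : Sweep
initialSweep = ⟪ (λ { zero → true ; (suc _) → false }) , initState , false ⟫

module _ {n : ℕ} (x : Vec Bool n) where

  -- An input read out of range makes run fail; the sweep reads F instead, which is harmless
  -- since only terminating runs are replayed.
  readInput : ℕ → Bool
  readInput i with i <? n
  ... | yes i<n = lookup x (fromℕ< i<n)
  ... | no  _   = false

  reply : BasicInstr → State → Bool
  reply (in:get i)    s = readInput i
  reply (aux:get i)   s = State.aux s i
  reply (aux:set i b) s = b
  reply (out:set b)   s = b

  perform : Bool → BasicInstr → State → State
  perform c (in:get i)    s = s
  perform c (aux:get i)   s = s
  perform c (aux:set i b) s = if c then ⟨ update (State.aux s) i b , State.out s ⟩ else s
  perform c (out:set b)   s = if c then ⟨ State.aux s , b ⟩ else s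

  perform-false : ∀ a s → perform false a s ≡ s
  perform-false (in:get i)    s = refl
  perform-false (aux:get i)   s = refl
  perform-false (aux:set i b) s = refl
  perform-false (out:set b)   s = refl

  doBasic-ok : ∀ a s {r s'} → doBasic x a s ≡ ok r s' → reply a s ≡ r × perform true a s ≡ s'
  doBasic-ok (in:get i) s eq with i <? n | eq
  ... | yes _ | refl = refl , refl
  ... | no  _ | ()
  doBasic-ok (aux:get i)   s refl = refl , refl
  doBasic-ok (aux:set i b) s refl = refl , refl
  doBasic-ok (out:set b)   s refl = refl , refl

  perform-aux:set : ∀ c i b s j →
    State.aux (perform c (aux:set i b) s) j ≡ update (State.aux s) i (if c then b else State.aux s i) j
  perform-aux:set true  i b s j = refl
  perform-aux:set false i b s j with i ≟ j
  ... | yes refl = refl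
  ... | no  _    = refl

  perform-out:set : ∀ c b s → perform c (out:set b) s ≡ ⟨ State.aux s , (if c then b else State.out s) ⟩
  perform-out:set true  b s = refl
  perform-out:set false b s = refl

  sweepStep : PrimInstr → Sweep → Sweep
  sweepStep (plain a)      ⟪ p , s , r ⟫ = ⟪ flowTo 0 (p 0) (shift p) , perform (p 0) a s , r ⟫
  sweepStep (ptest a)      ⟪ p , s , r ⟫ = ⟪ branch (p 0) (reply a s) p , perform (p 0) a s , r ⟫
  sweepStep (ntest a)      ⟪ p , s , r ⟫ = ⟪ branch (p 0) (notᵇ (reply a s)) p , perform (p 0) a s , r ⟫
  sweepStep (jump zero)    ⟪ p , s , r ⟫ = ⟪ shift p , s , r ⟫
  sweepStep (jump (suc l)) ⟪ p , s , r ⟫ = ⟪ flowTo l (p 0) (shift p) , s , r ⟫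
  sweepStep halt           ⟪ p , s , r ⟫ = ⟪ shift p , s , r ∨ (p 0 ∧ State.out s) ⟫

  sweep : List PrimInstr → Sweep → Sweep
  sweep []       c = c
  sweep (u ∷ us) c = sweep us (sweepStep u c)

  sweepStep-inactive : ∀ u c → Sweep.active c 0 ≡ false →
    (∀ j → Sweep.active (sweepStep u c) j ≡ Sweep.active c (suc j)) ×
    Sweep.state (sweepStep u c) ≡ Sweep.state c × Sweep.result (sweepStep u c) ≡ Sweep.result c
  sweepStep-inactive (plain a)      ⟪ p , s , r ⟫ p₀ rewrite p₀ =
    flowTo-false 0 (shift p) , perform-false a s , refl
  sweepStep-inactive (ptest a)      ⟪ p , s , r ⟫ p₀ rewrite p₀ = branch-false , perform-false a s , refl
    where
    branch-false : ∀ j → branch false (reply a s) p j ≡ p (suc j)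
    branch-false j = trans (flowTo-false 1 _ j) (flowTo-false 0 (shift p) j)
  sweepStep-inactive (ntest a)      ⟪ p , s , r ⟫ p₀ rewrite p₀ = branch-false , perform-false a s , refl
    where
    branch-false : ∀ j → branch false (notᵇ (reply a s)) p j ≡ p (suc j)
    branch-false j = trans (flowTo-false 1 _ j) (flowTo-false 0 (shift p) j)
  sweepStep-inactive (jump zero)    ⟪ p , s , r ⟫ p₀ = (λ j → refl) , refl , refl
  sweepStep-inactive (jump (suc l)) ⟪ p , s , r ⟫ p₀ rewrite p₀ = flowTo-false l (shift p) , refl , refl
  sweepStep-inactive halt           ⟪ p , s , r ⟫ p₀ rewrite p₀ = (λ j → refl) , refl , ∨-identityʳ r

  -- While control is still running, it sits at the single active position d; once the
  -- run has halted, no position is active and the result is final.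
  data Tracks (us : List PrimInstr) (c : Sweep) (o : Bool) : Set where
    running : ∀ d K → OnlyAt d (Sweep.active c) → Sweep.result c ≡ false →
              run x K (drop d us) (Sweep.state c) ≡ terminated o → Tracks us c o
    halted  : Silent (Sweep.active c) → Sweep.result c ≡ o → Tracks us c o

  run-[] : ∀ K s {o} → run x K [] s ≢ terminated o
  run-[] zero    s ()
  run-[] (suc K) s ()

  run-jump0 : ∀ K us s {o} → run x K (jump 0 ∷ us) s ≢ terminated o
  run-jump0 zero    us s ()
  run-jump0 (suc K) us s = run-jump0 K us s

  tracks-active : ∀ u us p s K {o} → OnlyAt 0 p → run x (suc K) (u ∷ us) s ≡ terminated o →
                  Tracks us (sweepStep u ⟪ p , s , false ⟫) o
  tracks-active halt us p s K (p₀ , silent) refl rewrite p₀ = halted silent refl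
  tracks-active (jump zero)    us p s K _ H = ⊥-elim (run-jump0 K us s H)
  tracks-active (jump (suc l)) us p s K (p₀ , silent) H rewrite p₀ =
    running l K (onlyAt-flowTo l silent) refl H
  tracks-active (plain a) us p s K (p₀ , silent) H rewrite p₀ with doBasic x a s in eq
  ... | ok _ s' rewrite proj₂ (doBasic-ok a s eq) = running 0 K (onlyAt-flowTo 0 silent) refl H
  tracks-active (ptest a) us p s K (p₀ , silent) H rewrite p₀ with doBasic x a s in eq
  ... | ok r s' rewrite proj₁ (doBasic-ok a s eq) | proj₂ (doBasic-ok a s eq) = continue r H
    where
    continue : ∀ r → run x K (if r then us else drop 1 us) s' ≡ _ →
               Tracks us ⟪ branch true r p , s' , false ⟫ _
    continue true  H = running 0 K (onlyAt-branch-true p silent) refl H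
    continue false H = running 1 K (onlyAt-branch-false p silent) refl H
  tracks-active (ntest a) us p s K (p₀ , silent) H rewrite p₀ with doBasic x a s in eq
  ... | ok r s' rewrite proj₁ (doBasic-ok a s eq) | proj₂ (doBasic-ok a s eq) = continue r H
    where
    continue : ∀ r → run x K (if r then drop 1 us else us) s' ≡ _ →
               Tracks us ⟪ branch true (notᵇ r) p , s' , false ⟫ _
    continue true  H = running 1 K (onlyAt-branch-false p silent) refl H
    continue false H = running 0 K (onlyAt-branch-true p silent) refl H

  tracks-step : ∀ u us c {o} → Tracks (u ∷ us) c o → Tracks us (sweepStep u c) o
  tracks-step u us c (halted silent res) with sweepStep-inactive u c (silent 0)
  ... | act , _ , res' = halted (λ j → trans (act j) (silent (suc j))) (trans res' res)
  tracks-step u us c (running (suc d) K (p₀ , only) res H) with sweepStep-inactive u c p₀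
  ... | act , st , res' = running d K (onlyAt-cong d (λ j → sym (act j)) only) (trans res' res)
                                  (subst (λ s → run x K (drop d us) s ≡ _) (sym st) H)
  tracks-step u us ⟪ p , s , r ⟫ (running zero zero only res ())
  tracks-step u us ⟪ p , s , r ⟫ (running zero (suc K) only refl H) = tracks-active u us p s K only H

  sweep-tracks : ∀ us c {o} → Tracks us c o → Sweep.result (sweep us c) ≡ o
  sweep-tracks []       c (running d K _ _ H) =
    ⊥-elim (run-[] K _ (subst (λ us → run x K us _ ≡ _) (drop-[] d) H))
  sweep-tracks []       c (halted _ res)      = res
  sweep-tracks (u ∷ us) c t                   = sweep-tracks us (sweepStep u c) (tracks-step u us c t)

-- The symbolic sweep

updateAt : ∀ {A : Set} → ℕ → A → (ℕ → A) → ℕ → A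
updateAt zero    v p zero    = v
updateAt zero    v p (suc j) = p (suc j)
updateAt (suc t) v p zero    = p 0
updateAt (suc t) v p (suc j) = updateAt t v (shift p) j

updateWire : (ℕ → ℕ) → ℕ → ℕ → ℕ → ℕ
updateWire ws i w j with i ≟ j
... | yes _ = w
... | no  _ = ws j

-- The symbolic sweep mirrors Sweep with every Boolean replaced by the level of a wire that
-- computes it; levels n and n+1 hold the constants F and T.
record SymState : Set where
  constructor ⟨_,_⟩ʷ
  field
    aux : ℕ → ℕ
    out : ℕ

record SymSweep : Set where
  constructor ⟪_,_,_,_⟫ʷ
  field
    gates  : List LGate
    active : ℕ → ℕ
    regs   : SymState
    result : ℕ

module Symbolic (n : ℕ) where

  constWire : Bool → ℕ
  constWire false = n
  constWire true  = suc n

  symFlowTo : ℕ → ℕ → (ℕ → ℕ) → List LGate → List LGate × (ℕ → ℕ)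
  symFlowTo t c ps P = or (ps t) c ∷ P , updateAt t (width {n} P) ps

  symBranch : ℕ → ℕ → (ℕ → ℕ) → List LGate → List LGate × (ℕ → ℕ)
  symBranch c r ps P =
    let (P₁ , ps₁) = symFlowTo 0 (width {n} P) (shift ps) (and c r ∷ P)
    in symFlowTo 1 (suc (width {n} P₁)) ps₁ (and c (width {n} P₁) ∷ not r ∷ P₁)

  symGuardedSet : ℕ → Bool → ℕ → List LGate → List LGate × ℕ
  symGuardedSet c true  old P = or c old ∷ P , width {n} P
  symGuardedSet c false old P = and (width {n} P) old ∷ not c ∷ P , suc (width {n} P)

  symReply : BasicInstr → SymState → ℕ
  symReply (in:get i) σ with i <? n
  ... | yes _ = n ∸ suc i
  ... | no  _ = constWire false
  symReply (aux:get i)   σ = SymState.aux σ i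
  symReply (aux:set i b) σ = constWire b
  symReply (out:set b)   σ = constWire b

  symPerform : ℕ → BasicInstr → List LGate → SymState → List LGate × SymState
  symPerform c (in:get i)    P σ = P , σ
  symPerform c (aux:get i)   P σ = P , σ
  symPerform c (aux:set i b) P ⟨ a , o ⟩ʷ =
    let (P' , w) = symGuardedSet c b (a i) P in P' , ⟨ updateWire a i w , o ⟩ʷ
  symPerform c (out:set b)   P ⟨ a , o ⟩ʷ = let (P' , w) = symGuardedSet c b o P in P' , ⟨ a , w ⟩ʷ

  symStep : PrimInstr → SymSweep → SymSweep
  symStep (plain a) ⟪ P , ps , σ , r ⟫ʷ =
    let (P₁ , σ₁)  = symPerform (ps 0) a P σ
        (P₂ , ps₂) = symFlowTo 0 (ps 0) (shift ps) P₁
    in ⟪ P₂ , ps₂ , σ₁ , r ⟫ʷ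
  symStep (ptest a) ⟪ P , ps , σ , r ⟫ʷ =
    let (P₁ , σ₁)  = symPerform (ps 0) a P σ
        (P₂ , ps₂) = symBranch (ps 0) (symReply a σ) ps P₁
    in ⟪ P₂ , ps₂ , σ₁ , r ⟫ʷ
  symStep (ntest a) ⟪ P , ps , σ , r ⟫ʷ =
    let (P₁ , σ₁)  = symPerform (ps 0) a P σ
        (P₂ , ps₂) = symBranch (ps 0) (width {n} P₁) ps (not (symReply a σ) ∷ P₁)
    in ⟪ P₂ , ps₂ , σ₁ , r ⟫ʷ
  symStep (jump zero) ⟪ P , ps , σ , r ⟫ʷ = ⟪ P , shift ps , σ , r ⟫ʷ
  symStep (jump (suc l)) ⟪ P , ps , σ , r ⟫ʷ =
    let (P₁ , ps₁) = symFlowTo l (ps 0) (shift ps) P in ⟪ P₁ , ps₁ , σ , r ⟫ʷ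
  symStep halt ⟪ P , ps , σ , r ⟫ʷ =
    ⟪ or r (width {n} P) ∷ and (ps 0) (SymState.out σ) ∷ P , shift ps , σ , suc (width {n} P) ⟫ʷ

  symSweep : List PrimInstr → SymSweep → SymSweep
  symSweep []       σ = σ
  symSweep (u ∷ us) σ = symSweep us (symStep u σ)

  length-symGuardedSet : ∀ c b old P → length (proj₁ (symGuardedSet c b old P)) ≤ 2 + length P
  length-symGuardedSet c true  old P = n≤1+n _
  length-symGuardedSet c false old P = ≤-refl

  length-symPerform : ∀ c a P σ → length (proj₁ (symPerform c a P σ)) ≤ 2 + length P
  length-symPerform c (in:get i)    P σ           = m≤n+m _ 2
  length-symPerform c (aux:get i)   P σ           = m≤n+m _ 2
  length-symPerform c (aux:set i b) P ⟨ a , o ⟩ʷ = length-symGuardedSet c b (a i) P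
  length-symPerform c (out:set b)   P ⟨ a , o ⟩ʷ = length-symGuardedSet c b o P

  gateCount : SymSweep → ℕ
  gateCount σ = length (SymSweep.gates σ)

  gateCount-symStep : ∀ u σ → gateCount (symStep u σ) ≤ 8 + gateCount σ
  gateCount-symStep (plain a)      ⟪ P , ps , σ , r ⟫ʷ =
    ≤-trans (+-monoʳ-≤ 1 (length-symPerform (ps 0) a P σ)) (+-monoˡ-≤ (length P) (m≤m+n 3 5))
  gateCount-symStep (ptest a)      ⟪ P , ps , σ , r ⟫ʷ =
    ≤-trans (+-monoʳ-≤ 5 (length-symPerform (ps 0) a P σ)) (+-monoˡ-≤ (length P) (m≤m+n 7 1))
  gateCount-symStep (ntest a)      ⟪ P , ps , σ , r ⟫ʷ = +-monoʳ-≤ 6 (length-symPerform (ps 0) a P σ)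
  gateCount-symStep (jump zero)    ⟪ P , ps , σ , r ⟫ʷ = m≤n+m _ 8
  gateCount-symStep (jump (suc l)) ⟪ P , ps , σ , r ⟫ʷ = s≤s (m≤n+m _ 7)
  gateCount-symStep halt           ⟪ P , ps , σ , r ⟫ʷ = s≤s (s≤s (m≤n+m _ 6))

  gateCount-symSweep : ∀ us σ → gateCount (symSweep us σ) ≤ 8 * length us + gateCount σ
  gateCount-symSweep []       σ = ≤-refl
  gateCount-symSweep (u ∷ us) σ = begin
    gateCount (symSweep us (symStep u σ))      ≤⟨ gateCount-symSweep us (symStep u σ) ⟩
    8 * length us + gateCount (symStep u σ)    ≤⟨ +-monoʳ-≤ (8 * length us) (gateCount-symStep u σ) ⟩
    8 * length us + (8 + gateCount σ)          ≡⟨ lemma (length us) (gateCount σ) ⟩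
    8 * length (u ∷ us) + gateCount σ          ∎
    where
    open ≤-Reasoning
    lemma : ∀ k l → 8 * k + (8 + l) ≡ 8 * suc k + l
    lemma = solve-∀

  initial : SymSweep
  initial = ⟪ const true ∷ const false ∷ [] , (λ { zero → constWire true ; (suc _) → constWire false }) ,
              ⟨ (λ _ → constWire false) , constWire false ⟩ʷ , constWire false ⟫ʷ

  -- The result wire is copied into a last gate, so that the output index needs no proof
  -- that the wire exists.
  sweepCircuit : List PrimInstr → Circuit n
  sweepCircuit us = record
    { size   = suc (length P)
    ; gates  = toGates (or r r ∷ P)
    ; output = zero }
    where
    P = SymSweep.gates (symSweep us initial)
    r = SymSweep.result (symSweep us initial)

  size-sweepCircuit : ∀ us → Circuit.size (sweepCircuit us) ≤ 3 + 8 * length us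
  size-sweepCircuit us =
    ≤-trans (s≤s (gateCount-symSweep us initial)) (≤-reflexive (cong suc (+-comm (8 * length us) 2)))

module _ {n : ℕ} (x : Vec Bool n) where

  open Symbolic n

  CarriesAll : List LGate → (ℕ → ℕ) → (ℕ → Bool) → Set
  CarriesAll P ws bs = ∀ j → Carries x P (ws j) (bs j)

  record CarriesState (P : List LGate) (σ : SymState) (s : State) : Set where
    constructor carriesState
    field
      aux : CarriesAll P (SymState.aux σ) (State.aux s)
      out : Carries x P (SymState.out σ) (State.out s)

  record Simulates (σ : SymSweep) (c : Sweep) : Set where
    constructor simulation
    field
      active    : CarriesAll (SymSweep.gates σ) (SymSweep.active σ) (Sweep.active c)
      state     : CarriesState (SymSweep.gates σ) (SymSweep.regs σ) (Sweep.state c)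
      result    : Carries x (SymSweep.gates σ) (SymSweep.result σ) (Sweep.result c)
      constants : ∀ b → Carries x (SymSweep.gates σ) (constWire b) b

  carriesAll-⊑ : ∀ {P Q ws bs} → P ⊑ Q → CarriesAll P ws bs → CarriesAll Q ws bs
  carriesAll-⊑ P⊑Q hs j = carries-⊑ P⊑Q (hs j)

  carriesState-⊑ : ∀ {P Q σ s} → P ⊑ Q → CarriesState P σ s → CarriesState Q σ s
  carriesState-⊑ P⊑Q (carriesState ha ho) = carriesState (carriesAll-⊑ P⊑Q ha) (carries-⊑ P⊑Q ho)

  carries-updateWire : ∀ {P ws bs w b} i → CarriesAll P ws bs → Carries x P w b →
                       CarriesAll P (updateWire ws i w) (update bs i b)
  carries-updateWire i hs h j with i ≟ j
  ... | yes _ = h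
  ... | no  _ = hs j

  carries-symFlowTo : ∀ t {P c cv ps p} → Carries x P c cv → CarriesAll P ps p →
                      CarriesAll (proj₁ (symFlowTo t c ps P)) (proj₂ (symFlowTo t c ps P)) (flowTo t cv p)
  carries-symFlowTo zero    hc hs zero    = carries-or (hs 0) hc
  carries-symFlowTo zero    hc hs (suc j) = carries-∷ (hs (suc j))
  carries-symFlowTo (suc t) hc hs zero    = carries-∷ (hs 0)
  carries-symFlowTo (suc t) hc hs (suc j) = carries-symFlowTo t hc (λ j → hs (suc j)) j

  carries-symBranch : ∀ {P c cv r rv ps p} → Carries x P c cv → Carries x P r rv → CarriesAll P ps p →
                      P ⊑ proj₁ (symBranch c r ps P) ×
                      CarriesAll (proj₁ (symBranch c r ps P)) (proj₂ (symBranch c r ps P)) (branch cv rv p)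
  carries-symBranch hc hr hs =
    ⊑-∷ (⊑-∷ (⊑-∷ (⊑-∷ (⊑-∷ ⊑-refl)))) ,
    carries-symFlowTo 1 else-wire (carriesAll-⊑ (⊑-∷ (⊑-∷ ⊑-refl)) then-flow)
    where
    then-flow = carries-symFlowTo 0 (carries-and hc hr) (λ j → carries-∷ (hs (suc j)))
    else-wire = carries-and (carries-⊑ (⊑-∷ (⊑-∷ (⊑-∷ ⊑-refl))) hc)
                            (carries-not (carries-⊑ (⊑-∷ (⊑-∷ ⊑-refl)) hr))

  carries-symGuardedSet : ∀ {P c cv old ov} b → Carries x P c cv → Carries x P old ov →
    P ⊑ proj₁ (symGuardedSet c b old P) ×
    Carries x (proj₁ (symGuardedSet c b old P)) (proj₂ (symGuardedSet c b old P)) (if cv then b else ov)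
  carries-symGuardedSet {cv = cv} {ov = ov} true hc hold =
    ⊑-∷ ⊑-refl , subst (Carries x _ _) (set-value cv) (carries-or hc hold)
    where
    set-value : ∀ cv → cv ∨ ov ≡ (if cv then true else ov)
    set-value true  = refl
    set-value false = refl
  carries-symGuardedSet {cv = cv} {ov = ov} false hc hold =
    ⊑-∷ (⊑-∷ ⊑-refl) , subst (Carries x _ _) (clear-value cv) (carries-and (carries-not hc) (carries-∷ hold))
    where
    clear-value : ∀ cv → notᵇ cv ∧ ov ≡ (if cv then false else ov)
    clear-value true  = refl
    clear-value false = refl

  carries-symReply : ∀ {P σ s} a → CarriesState P σ s → (∀ b → Carries x P (constWire b) b) →
                     Carries x P (symReply a σ) (reply x a s)
  carries-symReply {P} (in:get i) hσ consts with i <? n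
  ... | yes i<n = carries-input P i<n
  ... | no  _   = consts false
  carries-symReply (aux:get i)   hσ consts = CarriesState.aux hσ i
  carries-symReply (aux:set i b) hσ consts = consts b
  carries-symReply (out:set b)   hσ consts = consts b

  carries-symPerform : ∀ {P c cv σ s} a → Carries x P c cv → CarriesState P σ s →
    P ⊑ proj₁ (symPerform c a P σ) ×
    CarriesState (proj₁ (symPerform c a P σ)) (proj₂ (symPerform c a P σ)) (perform x cv a s)
  carries-symPerform (in:get i)  hc hσ = ⊑-refl , hσ
  carries-symPerform (aux:get i) hc hσ = ⊑-refl , hσ
  carries-symPerform {cv = cv} {s = s} (aux:set i b) hc (carriesState ha ho)
    with carries-symGuardedSet b hc (ha i)
  ... | P⊑P' , hw = P⊑P' , carriesState
    (λ j → subst (Carries x _ _) (sym (perform-aux:set x cv i b s j))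
                 (carries-updateWire i (carriesAll-⊑ P⊑P' ha) hw j))
    (subst (Carries x _ _) (out-unchanged cv) (carries-⊑ P⊑P' ho))
    where
    out-unchanged : ∀ cv → State.out s ≡ State.out (perform x cv (aux:set i b) s)
    out-unchanged true  = refl
    out-unchanged false = refl
  carries-symPerform {cv = cv} {s = s} (out:set b) hc (carriesState ha ho)
    with carries-symGuardedSet b hc ho
  ... | P⊑P' , hw rewrite perform-out:set x cv b s = P⊑P' , carriesState (carriesAll-⊑ P⊑P' ha) hw

  simulates-extend : ∀ {P P' ps' σ' r p' s' rv} → P ⊑ P' → CarriesAll P' ps' p' → CarriesState P' σ' s' →
                     Carries x P r rv → (∀ b → Carries x P (constWire b) b) →
                     Simulates ⟪ P' , ps' , σ' , r ⟫ʷ ⟪ p' , s' , rv ⟫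
  simulates-extend P⊑P' hps hσ hr consts =
    simulation hps hσ (carries-⊑ P⊑P' hr) (λ b → carries-⊑ P⊑P' (consts b))

  simulates-symStep : ∀ u σ c → Simulates σ c → Simulates (symStep u σ) (sweepStep x u c)
  simulates-symStep (plain a) ⟪ P , ps , σ , r ⟫ʷ ⟪ p , s , rv ⟫ (simulation hp hσ hr consts)
    with carries-symPerform a (hp 0) hσ
  ... | ⊑₁ , hσ₁ =
    simulates-extend (⊑-trans ⊑₁ (⊑-∷ ⊑-refl))
                     (carries-symFlowTo 0 (carries-⊑ ⊑₁ (hp 0)) (λ j → carries-⊑ ⊑₁ (hp (suc j))))
                     (carriesState-⊑ (⊑-∷ ⊑-refl) hσ₁) hr consts
  simulates-symStep (ptest a) ⟪ P , ps , σ , r ⟫ʷ ⟪ p , s , rv ⟫ (simulation hp hσ hr consts)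
    with carries-symPerform a (hp 0) hσ
  ... | ⊑₁ , hσ₁
    with carries-symBranch (carries-⊑ ⊑₁ (hp 0)) (carries-⊑ ⊑₁ (carries-symReply a hσ consts)) (carriesAll-⊑ ⊑₁ hp)
  ... | ⊑₂ , hps₂ = simulates-extend (⊑-trans ⊑₁ ⊑₂) hps₂ (carriesState-⊑ ⊑₂ hσ₁) hr consts
  simulates-symStep (ntest a) ⟪ P , ps , σ , r ⟫ʷ ⟪ p , s , rv ⟫ (simulation hp hσ hr consts)
    with carries-symPerform a (hp 0) hσ
  ... | ⊑₁ , hσ₁
    with carries-symBranch (carries-∷ (carries-⊑ ⊑₁ (hp 0))) (carries-not (carries-⊑ ⊑₁ (carries-symReply a hσ consts)))
                           (λ j → carries-∷ (carries-⊑ ⊑₁ (hp j)))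
  ... | ⊑₂ , hps₂ = simulates-extend (⊑-trans ⊑₁ ⊑₁₂) hps₂ (carriesState-⊑ ⊑₁₂ hσ₁) hr consts
    where ⊑₁₂ = ⊑-trans (⊑-∷ ⊑-refl) ⊑₂
  simulates-symStep (jump zero) ⟪ P , ps , σ , r ⟫ʷ ⟪ p , s , rv ⟫ (simulation hp hσ hr consts) =
    simulation (λ j → hp (suc j)) hσ hr consts
  simulates-symStep (jump (suc l)) ⟪ P , ps , σ , r ⟫ʷ ⟪ p , s , rv ⟫ (simulation hp hσ hr consts) =
    simulates-extend (⊑-∷ ⊑-refl) (carries-symFlowTo l (hp 0) (λ j → hp (suc j)))
                     (carriesState-⊑ (⊑-∷ ⊑-refl) hσ) hr consts
  simulates-symStep halt ⟪ P , ps , σ , r ⟫ʷ ⟪ p , s , rv ⟫ (simulation hp hσ hr consts) =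
    simulation (λ j → carries-⊑ ⊑₂ (hp (suc j))) (carriesState-⊑ ⊑₂ hσ)
               (carries-or (carries-∷ hr) (carries-and (hp 0) (CarriesState.out hσ)))
               (λ b → carries-⊑ ⊑₂ (consts b))
    where ⊑₂ = ⊑-∷ (⊑-∷ ⊑-refl)

  simulates-symSweep : ∀ us σ c → Simulates σ c → Simulates (symSweep us σ) (sweep x us c)
  simulates-symSweep []       σ c h = h
  simulates-symSweep (u ∷ us) σ c h =
    simulates-symSweep us (symStep u σ) (sweepStep x u c) (simulates-symStep u σ c h)

  simulates-initial : Simulates initial initialSweep
  simulates-initial = simulation (λ { zero → consts true ; (suc j) → consts false })
                                 (carriesState (λ _ → consts false) (consts false)) (consts false) consts
    where
    consts : ∀ b → Carries x (const true ∷ const false ∷ []) (constWire b) b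
    consts false = carries-∷ (carries-new (const false) refl)
    consts true  = carries-new (const true) refl

  evalCircuit-sweepCircuit : ∀ us → evalCircuit (sweepCircuit us) x ≡ Sweep.result (sweep x us initialSweep)
  evalCircuit-sweepCircuit us = begin
    evalGate v (indexGate (or r r))     ≡⟨ evalGate-indexGate v (or r r) ⟩
    lookupLevel v r ∨ lookupLevel v r   ≡⟨ ∨-idem _ ⟩
    lookupLevel v r                     ≡⟨ lookupLevel-wires x P r ⟩
    wireValue x P r                     ≡⟨ Carries.value (Simulates.result (simulates-symSweep us _ _ simulates-initial)) ⟩
    Sweep.result (sweep x us initialSweep) ∎
    where
    open ≡-Reasoning
    P = SymSweep.gates (symSweep us initial)
    r = SymSweep.result (symSweep us initial)
    v = wires (toGates P) x

-- The two inclusions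

sweepCircuit-computes : ∀ {n} X {f : Vec Bool n → Bool} → Computes X f →
                        ∀ x → evalCircuit (Symbolic.sweepCircuit n (toList X)) x ≡ f x
sweepCircuit-computes X computes x = trans (evalCircuit-sweepCircuit x (toList X))
  (sweep-tracks x (toList X) initialSweep (running 0 (suc (isLength X)) (refl , λ _ → refl) refl (computes x)))

circuitCode-computes : ∀ {n} (C : Circuit n) {f : Vec Bool n → Bool} → (∀ x → evalCircuit C x ≡ f x) →
                       Computes (circuitCode C) f
circuitCode-computes C correct x = trans (execute-circuitCode x C) (cong terminated (correct x))

P-IS⇒P/poly : ∀ f → P-IS f → P/poly f
P-IS⇒P/poly f (h , program) = affinePoly 3 8 h , λ n →
  let (X , computes , |X|≤h) = program n in
  Symbolic.sweepCircuit n (toList X) , sweepCircuit-computes X computes ,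
  ≤-trans (Symbolic.size-sweepCircuit n (toList X)) (affinePoly-bound 3 8 h |X|≤h)

P/poly⇒P-IS : ∀ f → P/poly f → P-IS f
P/poly⇒P-IS f (h , circuit) = affinePoly 4 4 h , λ n →
  let (C , correct , size≤h) = circuit n in
  circuitCode C , circuitCode-computes C correct ,
  ≤-trans (isLength-circuitCode C) (affinePoly-bound 4 4 h size≤h)

theorem5 : (f : BoolFunFamily) → P-IS f ⇔ P/poly f
theorem5 f = mk⇔ (P-IS⇒P/poly f) (P/poly⇒P-IS f)
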